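{- Let $n\ge 2$. Then (i) $\det(B_{3,n})=n$; (iii) $\rho^u(B_{3,n})=n$; and (iv) $\operatorname{Dist}_f(B_{3,n})=n$.
   Context: The book graph $B_{3,n}$ consists of $n$ copies of the triangle $C_3$ identified along a single common edge. A $d$-distinguishing coloring of a graph $G$ is an assignment of colors from a set of $d$ colors to the vertices such that the only automorphism mapping each color class to itself is the identity; $\operatorname{Dist}(G)$ is the least $d$ for which one exists. The paint cost $\rho^d(G)$ is the minimum of $|V(G)\setminus T|$ over all $d$-distinguishing colorings and all their color classes $T$; the upper paint cost is $\rho^u(G)=\rho^{\operatorname{Dist}(G)}(G)$. A determining set is a set $S\subseteq V(G)$ such that only the identity automorphism fixes every vertex of $S$; $\det(G)$ is its minimum size. The frugal distinguishing number $\operatorname{Dist}_f(G)$ is the smallest $d$ for which $\rho^d(G)=\det(G)$. -}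

module Defs where

open import Data.Nat using (ℕ; _+_; _≤_; _<_)
open import Data.Nat.Base using (_<ᵇ_)
open import Data.Bool using (Bool; true; false; not; _∧_; _∨_)
open import Data.Fin using (Fin; toℕ; _≟_)
open import Data.Fin.Subset using (Subset; inside; outside; _∈_; ∁; ∣_∣)
open import Data.Fin.Permutation using (Permutation′; _⟨$⟩ʳ_)
open import Data.Vec using (tabulate)
open import Data.Product using (Σ; _×_; ∃)
open import Relation.Nullary.Decidable using (⌊_⌋)
open import Relation.Binary.PropositionalEquality using (_≡_)

Graph : ℕ → Set
Graph m = Fin m → Fin m → Bool

-- Book graph B_{3,n}: vertices Fin (n + 2); vertices 0 and 1 form the spine
-- (common edge), vertices 2 .. n+1 are the apexes of the n triangles.
isSpine : ∀ {m} → Fin m → Bool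
isSpine x = toℕ x <ᵇ 2

book3 : (n : ℕ) → Graph (n + 2)
book3 n x y = not ⌊ x ≟ y ⌋ ∧ (isSpine x ∨ isSpine y)

IsAut : ∀ {m} → Graph m → Permutation′ m → Set
IsAut G σ = ∀ x y → G (σ ⟨$⟩ʳ x) (σ ⟨$⟩ʳ y) ≡ G x y

IsIdentity : ∀ {m} → Permutation′ m → Set
IsIdentity σ = ∀ x → σ ⟨$⟩ʳ x ≡ x

IsDetermining : ∀ {m} → Graph m → Subset m → Set
IsDetermining G S = ∀ σ → IsAut G σ → (∀ x → x ∈ S → σ ⟨$⟩ʳ x ≡ x) → IsIdentity σ

IsDet : ∀ {m} → Graph m → ℕ → Set
IsDet G k = (Σ _ λ S → IsDetermining G S × ∣ S ∣ ≡ k)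
          × (∀ S → IsDetermining G S → k ≤ ∣ S ∣)

Coloring : ℕ → ℕ → Set
Coloring m d = Fin m → Fin d

IsDistinguishing : ∀ {m d} → Graph m → Coloring m d → Set
IsDistinguishing G c = ∀ σ → IsAut G σ → (∀ x → c (σ ⟨$⟩ʳ x) ≡ c x) → IsIdentity σ

HasDistColoring : ∀ {m} → Graph m → ℕ → Set
HasDistColoring {m} G d = Σ (Coloring m d) (IsDistinguishing G)

IsDist : ∀ {m} → Graph m → ℕ → Set
IsDist G d = HasDistColoring G d × (∀ d' → HasDistColoring G d' → d ≤ d')

colorClass : ∀ {m d} → Coloring m d → Fin d → Subset m
colorClass c i = tabulate (λ x → ⌊ c x ≟ i ⌋)

paintCost : ∀ {m d} → Coloring m d → Fin d → ℕ
paintCost c i = ∣ ∁ (colorClass c i) ∣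

IsPaintCost : ∀ {m} → Graph m → ℕ → ℕ → Set
IsPaintCost {m} G d r =
  (Σ (Coloring m d) λ c → IsDistinguishing G c × Σ (Fin d) λ i → paintCost c i ≡ r)
  × (∀ (c : Coloring m d) → IsDistinguishing G c → ∀ i → r ≤ paintCost c i)

IsUpperPaintCost : ∀ {m} → Graph m → ℕ → Set
IsUpperPaintCost G r = ∃ λ d → IsDist G d × IsPaintCost G d r

RhoEqDet : ∀ {m} → Graph m → ℕ → Set
RhoEqDet G d = ∃ λ k → IsDet G k × IsPaintCost G d k

IsFrugalDist : ∀ {m} → Graph m → ℕ → Set
IsFrugalDist G d = RhoEqDet G d × (∀ d' → RhoEqDet G d' → d ≤ d')

{-# OPTIONS --safe #-}
module Submission where

-- Every permutation preserving the spine {0, 1} is an automorphism of the book, and for n ≥ 2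
-- every automorphism preserves the spine, since the spine vertices are exactly the universal
-- ones. So any two vertices on the same side are swapped by an automorphism: a determining set
-- misses at most one vertex per side, a colour class of a distinguishing colouring has at most
-- one vertex per side, and the n apexes need n distinct colours. Colouring the apexes 1, …, n
-- and the spine vertices 1 and 2 meets all three bounds, and removing its two-element colour
-- class 1 leaves a determining set of size n.

open import Defs
open import Data.Bool using (true; false; not; _∧_; _∨_)
open import Data.Empty using (⊥-elim)
open import Data.Fin using (Fin; zero; suc; punchOut; _≟_)
open import Data.Fin.Permutation using (Permutation′; _⟨$⟩ʳ_; _⟨$⟩ˡ_; inverseˡ; inverseʳ; flip; transpose)
open import Data.Fin.Properties using (2↔Bool; ¬Fin0; 0≢1+n; suc-injective; punchOut-injective; injective⇒≤)
open import Data.Fin.Subset using (Subset; inside; outside; _∈_; _∉_; ∁; ∣_∣)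
open import Data.Fin.Subset.Properties using (∣p∣≤n; ∣∁p∣≡n∸∣p∣; x∈p⇒∣p-x∣<∣p∣; x∈p∧x≢y⇒x∈p-y; x∉p⇒x∈∁p; x∈∁p⇒x∉p)
open import Data.Nat using (ℕ; _+_; _∸_; _≤_; z≤n; s≤s)
open import Data.Nat.Properties using (≤-trans; ≤-antisym; ∸-monoʳ-≤; m∸[m∸n]≡n; +-comm; module ≤-Reasoning)
open import Data.Product using (_×_; _,_)
open import Data.Vec using ([]; _∷_; here; there; lookup)
open import Data.Vec.Properties using (lookup∘tabulate; lookup⇒[]=; []=⇒lookup)
open import Function using (_∘_)
open import Function.Bundles using (Inverse; Injection)
open import Function.Properties.Inverse using (↔-sym; ↔⇒↣)
open import Relation.Nullary using (¬_; Dec; does; yes; no)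
open import Relation.Nullary.Decidable using (⌊_⌋; isYes≗does; dec-true; dec-false)
open import Relation.Binary.PropositionalEquality

private variable
  A : Set
  N d k : ℕ

injectiveOn⇒∣p∣≤ : {p : Subset N} (f : ∀ {x} → x ∈ p → Fin k) →
                   (∀ {x y} (x∈p : x ∈ p) (y∈p : y ∈ p) → f x∈p ≡ f y∈p → x ≡ y) →
                   ∣ p ∣ ≤ k
injectiveOn⇒∣p∣≤ {p = []} f inj = z≤n
injectiveOn⇒∣p∣≤ {p = outside ∷ p} f inj =
  injectiveOn⇒∣p∣≤ (f ∘ there) (λ x∈p y∈p e → suc-injective (inj (there x∈p) (there y∈p) e))
injectiveOn⇒∣p∣≤ {k = ℕ.zero} {p = inside ∷ p} f inj = ⊥-elim (¬Fin0 (f here))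
injectiveOn⇒∣p∣≤ {k = ℕ.suc k} {p = inside ∷ p} f inj = s≤s (injectiveOn⇒∣p∣≤ g g-injective)
  where
  f-here≢ : ∀ {y} (y∈p : y ∈ p) → f here ≢ f (there y∈p)
  f-here≢ y∈p e = 0≢1+n (inj here (there y∈p) e)

  g : ∀ {y} → y ∈ p → Fin k
  g y∈p = punchOut (f-here≢ y∈p)

  g-injective : ∀ {x y} (x∈p : x ∈ p) (y∈p : y ∈ p) → g x∈p ≡ g y∈p → x ≡ y
  g-injective x∈p y∈p e =
    suc-injective (inj (there x∈p) (there y∈p) (punchOut-injective (f-here≢ x∈p) (f-here≢ y∈p) e))

x∈p∧y∈p∧x≢y⇒2≤∣p∣ : {p : Subset N} {x y : Fin N} → x ∈ p → y ∈ p → x ≢ y → 2 ≤ ∣ p ∣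
x∈p∧y∈p∧x≢y⇒2≤∣p∣ x∈p y∈p x≢y =
  ≤-trans (s≤s (≤-trans (s≤s z≤n) (x∈p⇒∣p-x∣<∣p∣ (x∈p∧x≢y⇒x∈p-y y∈p (x≢y ∘ sym)))))
          (x∈p⇒∣p-x∣<∣p∣ x∈p)

∣∁p∣≤k⇒n∸k≤∣p∣ : (p : Subset N) → ∣ ∁ p ∣ ≤ k → N ∸ k ≤ ∣ p ∣
∣∁p∣≤k⇒n∸k≤∣p∣ {N} {k} p ∣∁p∣≤k = begin
  N ∸ k           ≤⟨ ∸-monoʳ-≤ N ∣∁p∣≤k ⟩
  N ∸ ∣ ∁ p ∣       ≡⟨ cong (N ∸_) (∣∁p∣≡n∸∣p∣ p) ⟩
  N ∸ (N ∸ ∣ p ∣)   ≡⟨ m∸[m∸n]≡n (∣p∣≤n p) ⟩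
  ∣ p ∣             ∎
  where open ≤-Reasoning

module _ (u v : Fin N) where

  transpose-matchˡ : transpose u v ⟨$⟩ʳ u ≡ v
  transpose-matchˡ rewrite dec-true (u ≟ u) refl = refl

  transpose-matchʳ : transpose u v ⟨$⟩ʳ v ≡ u
  transpose-matchʳ with u ≟ v
  ... | yes refl rewrite dec-true (u ≟ u) refl = refl
  ... | no u≢v rewrite dec-false (v ≟ u) (u≢v ∘ sym) | dec-true (v ≟ v) refl = refl

  transpose-mismatch : ∀ {x} → x ≢ u → x ≢ v → transpose u v ⟨$⟩ʳ x ≡ x
  transpose-mismatch {x} x≢u x≢v rewrite dec-false (x ≟ u) x≢u | dec-false (x ≟ v) x≢v = refl

  transpose-preserves : (f : Fin N → A) → f u ≡ f v → ∀ x → f (transpose u v ⟨$⟩ʳ x) ≡ f x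
  transpose-preserves f fu≡fv x = by-cases (x ≟ u) (x ≟ v)
    where
    by-cases : Dec (x ≡ u) → Dec (x ≡ v) → f (transpose u v ⟨$⟩ʳ x) ≡ f x
    by-cases (yes refl) _        = trans (cong f transpose-matchˡ) (sym fu≡fv)
    by-cases (no _)     (yes refl) = trans (cong f transpose-matchʳ) fu≡fv
    by-cases (no x≢u)   (no x≢v)   = cong f (transpose-mismatch x≢u x≢v)

permutation-injective : (σ : Permutation′ N) {x y : Fin N} → σ ⟨$⟩ʳ x ≡ σ ⟨$⟩ʳ y → x ≡ y
permutation-injective σ = Injection.injective (↔⇒↣ σ)

Twins : Graph N → Fin N → Fin N → Set
Twins G u v = IsAut G (transpose u v)

distinguishing-separates-twins : {G : Graph N} {c : Coloring N d} → IsDistinguishing G c →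
                                 ∀ {u v} → Twins G u v → c u ≡ c v → u ≡ v
distinguishing-separates-twins {c = c} dist {u} {v} twins cu≡cv =
  trans (sym (dist (transpose u v) twins (transpose-preserves u v c cu≡cv) u)) (transpose-matchˡ u v)

determining-separates-twins : {G : Graph N} {S : Subset N} → IsDetermining G S →
                              ∀ {u v} → Twins G u v → u ∉ S → v ∉ S → u ≡ v
determining-separates-twins {S = S} det {u} {v} twins u∉S v∉S =
  trans (sym (det (transpose u v) twins fixes u)) (transpose-matchˡ u v)
  where
  fixes : ∀ x → x ∈ S → transpose u v ⟨$⟩ʳ x ≡ x
  fixes x x∈S = transpose-mismatch u v (λ { refl → u∉S x∈S }) (λ { refl → v∉S x∈S })

colorClass⁺ : (c : Coloring N d) {i : Fin d} {x : Fin N} → c x ≡ i → x ∈ colorClass c i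
colorClass⁺ c {i} {x} cx≡i = lookup⇒[]= x _ (begin
  lookup (colorClass c i) x  ≡⟨ lookup∘tabulate _ x ⟩
  ⌊ c x ≟ i ⌋                ≡⟨ isYes≗does (c x ≟ i) ⟩
  does (c x ≟ i)             ≡⟨ dec-true (c x ≟ i) cx≡i ⟩
  true                       ∎)
  where open ≡-Reasoning

colorClass⁻ : (c : Coloring N d) {i : Fin d} {x : Fin N} → x ∈ colorClass c i → c x ≡ i
colorClass⁻ c {i} {x} x∈T
  with c x ≟ i | trans (sym (lookup∘tabulate (λ y → ⌊ c y ≟ i ⌋) x)) ([]=⇒lookup x∈T)
... | yes cx≡i | _ = cx≡i
... | no _     | ()

∁colorClass-determining : {G : Graph N} {c : Coloring N d} → IsDistinguishing G c →
                          ∀ i → IsDetermining G (∁ (colorClass c i))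
∁colorClass-determining {c = c} dist i σ aut fixes = dist σ aut preserves
  where
  fixed : ∀ {x} → c x ≢ i → σ ⟨$⟩ʳ x ≡ x
  fixed cx≢i = fixes _ (x∉p⇒x∈∁p (cx≢i ∘ colorClass⁻ c))

  -- σ fixes the complement of the class pointwise, so by injectivity it maps the class into itself.
  preserves : ∀ x → c (σ ⟨$⟩ʳ x) ≡ c x
  preserves x with c x ≟ i | c (σ ⟨$⟩ʳ x) ≟ i
  ... | no cx≢i  | _         = cong c (fixed cx≢i)
  ... | yes cx≡i | yes cσx≡i = trans cσx≡i (sym cx≡i)
  ... | yes cx≡i | no cσx≢i  =
    ⊥-elim (cσx≢i (trans (cong c (permutation-injective σ (fixed cσx≢i))) cx≡i))

Universal : Graph N → Fin N → Set
Universal G x = ∀ y → x ≢ y → G x y ≡ true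

aut-preserves-universal : {G : Graph N} (σ : Permutation′ N) → IsAut G σ →
                          ∀ {x} → Universal G x → Universal G (σ ⟨$⟩ʳ x)
aut-preserves-universal {G = G} σ aut {x} universal y σx≢y = begin
  G (σ ⟨$⟩ʳ x) y                    ≡⟨ cong (G _) (sym (inverseʳ σ)) ⟩
  G (σ ⟨$⟩ʳ x) (σ ⟨$⟩ʳ (σ ⟨$⟩ˡ y))  ≡⟨ aut x _ ⟩
  G x (σ ⟨$⟩ˡ y)                    ≡⟨ universal _ (λ { refl → σx≢y (inverseʳ σ) }) ⟩
  true                              ∎
  where open ≡-Reasoning

aut-inverse : {G : Graph N} (σ : Permutation′ N) → IsAut G σ → IsAut G (flip σ)
aut-inverse {G = G} σ aut x y = trans (sym (aut _ _)) (cong₂ G (inverseʳ σ) (inverseʳ σ))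

aut-reflects-universal : {G : Graph N} (σ : Permutation′ N) → IsAut G σ →
                         ∀ {x} → Universal G (σ ⟨$⟩ʳ x) → Universal G x
aut-reflects-universal {G = G} σ aut universal =
  subst (Universal G) (inverseˡ σ) (aut-preserves-universal (flip σ) (aut-inverse σ aut) universal)

-- book3 n is bookOn (n + 2) by definition; on 2 + n vertices the vertices can be matched as
-- the spine zero, suc zero and the apexes suc (suc a) with a : Fin n.
bookOn : (N : ℕ) → Graph N
bookOn N x y = not ⌊ x ≟ y ⌋ ∧ (isSpine x ∨ isSpine y)

spine-preserving⇒aut : (σ : Permutation′ N) → (∀ x → isSpine (σ ⟨$⟩ʳ x) ≡ isSpine x) →
                       IsAut (bookOn N) σ
spine-preserving⇒aut σ preserves x y =
  cong₂ (λ e s → not e ∧ s) ≟-preserved (cong₂ _∨_ (preserves x) (preserves y))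
  where
  ≟-preserved : ⌊ σ ⟨$⟩ʳ x ≟ σ ⟨$⟩ʳ y ⌋ ≡ ⌊ x ≟ y ⌋
  ≟-preserved with x ≟ y | σ ⟨$⟩ʳ x ≟ σ ⟨$⟩ʳ y
  ... | yes _   | yes _     = refl
  ... | no _    | no _      = refl
  ... | yes x≡y | no σx≢σy  = ⊥-elim (σx≢σy (cong (σ ⟨$⟩ʳ_) x≡y))
  ... | no x≢y  | yes σx≡σy = ⊥-elim (x≢y (permutation-injective σ σx≡σy))

same-side⇒twins : {u v : Fin N} → isSpine u ≡ isSpine v → Twins (bookOn N) u v
same-side⇒twins {u = u} {v} same =
  spine-preserving⇒aut (transpose u v) (transpose-preserves u v isSpine same)

side : Fin N → Fin 2
side x = Inverse.from 2↔Bool (isSpine x)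

side-injective : {x y : Fin N} → side x ≡ side y → isSpine x ≡ isSpine y
side-injective = Injection.injective (↔⇒↣ (↔-sym 2↔Bool))

one-per-side⇒∣p∣≤2 : {p : Subset N} → (∀ {x y} → x ∈ p → y ∈ p → isSpine x ≡ isSpine y → x ≡ y) →
                     ∣ p ∣ ≤ 2
one-per-side⇒∣p∣≤2 one-per-side =
  injectiveOn⇒∣p∣≤ (λ {x} _ → side x)
    (λ {x} {y} x∈p y∈p e → one-per-side x∈p y∈p (side-injective {x = x} {y = y} e))

book-determining-size≥ : {S : Subset N} → IsDetermining (bookOn N) S → N ∸ 2 ≤ ∣ S ∣
book-determining-size≥ {S = S} det = ∣∁p∣≤k⇒n∸k≤∣p∣ S (one-per-side⇒∣p∣≤2 λ u∈∁S v∈∁S same →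
  determining-separates-twins det (same-side⇒twins same) (x∈∁p⇒x∉p u∈∁S) (x∈∁p⇒x∉p v∈∁S))

book-colorClass-size≤2 : {c : Coloring N d} → IsDistinguishing (bookOn N) c →
                         ∀ i → ∣ colorClass c i ∣ ≤ 2
book-colorClass-size≤2 {c = c} dist i = one-per-side⇒∣p∣≤2 λ u∈T v∈T same →
  distinguishing-separates-twins dist (same-side⇒twins same)
    (trans (colorClass⁻ c u∈T) (sym (colorClass⁻ c v∈T)))

book-paintCost≥ : {c : Coloring N d} → IsDistinguishing (bookOn N) c → ∀ i → N ∸ 2 ≤ paintCost c i
book-paintCost≥ {N = N} {c = c} dist i =
  subst (N ∸ 2 ≤_) (sym (∣∁p∣≡n∸∣p∣ (colorClass c i))) (∸-monoʳ-≤ N (book-colorClass-size≤2 dist i))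

book-colors≥apexes : ∀ {n} {c : Coloring (2 + n) d} → IsDistinguishing (bookOn (2 + n)) c → n ≤ d
book-colors≥apexes dist =
  injective⇒≤ λ e →
    suc-injective (suc-injective (distinguishing-separates-twins dist (same-side⇒twins refl) e))

spine⇒universal : {x : Fin N} → isSpine x ≡ true → Universal (bookOn N) x
spine⇒universal {x = x} spine y x≢y
  rewrite isYes≗does (x ≟ y) | dec-false (x ≟ y) x≢y | spine = refl

apex⇒¬universal : (x : Fin (4 + k)) → isSpine x ≡ false → ¬ Universal (bookOn (4 + k)) x
apex⇒¬universal (suc (suc zero)) _ universal with universal (suc (suc (suc zero))) (λ ())
... | ()
apex⇒¬universal (suc (suc (suc a))) _ universal with universal (suc (suc zero)) (λ ())
... | ()

book-aut-preserves-spine : (σ : Permutation′ (4 + k)) → IsAut (bookOn (4 + k)) σ →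
                           ∀ x → isSpine (σ ⟨$⟩ʳ x) ≡ isSpine x
book-aut-preserves-spine σ aut x with isSpine x in spine-x | isSpine (σ ⟨$⟩ʳ x) in spine-σx
... | true  | true  = refl
... | false | false = refl
... | true  | false =
  ⊥-elim (apex⇒¬universal _ spine-σx (aut-preserves-universal σ aut (spine⇒universal spine-x)))
... | false | true  =
  ⊥-elim (apex⇒¬universal x spine-x (aut-reflects-universal σ aut (spine⇒universal spine-σx)))

bookColoring : Coloring (4 + k) (2 + k)
bookColoring zero             = zero
bookColoring (suc zero)       = suc zero
bookColoring (suc (suc apex)) = apex

bookColoring-injective-per-side : (x y : Fin (4 + k)) → bookColoring x ≡ bookColoring y →
                                  isSpine x ≡ isSpine y → x ≡ y
bookColoring-injective-per-side zero             zero             _ _ = refl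
bookColoring-injective-per-side (suc zero)       (suc zero)       _ _ = refl
bookColoring-injective-per-side (suc (suc a))    (suc (suc b))    e _ = cong (suc ∘ suc) e
bookColoring-injective-per-side zero             (suc zero)       () _
bookColoring-injective-per-side (suc zero)       zero             () _
bookColoring-injective-per-side zero             (suc (suc _))    _ ()
bookColoring-injective-per-side (suc zero)       (suc (suc _))    _ ()
bookColoring-injective-per-side (suc (suc _))    zero             _ ()
bookColoring-injective-per-side (suc (suc _))    (suc zero)       _ ()

bookColoring-distinguishing : IsDistinguishing (bookOn (4 + k)) (bookColoring {k})
bookColoring-distinguishing σ aut preserves x =
  sym (bookColoring-injective-per-side x _
         (sym (preserves x)) (sym (book-aut-preserves-spine σ aut x)))

bookColoring-paintCost : paintCost (bookColoring {k}) zero ≡ 2 + k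
bookColoring-paintCost {k} = begin
  ∣ ∁ T ∣         ≡⟨ ∣∁p∣≡n∸∣p∣ T ⟩
  4 + k ∸ ∣ T ∣   ≡⟨ cong (4 + k ∸_) ∣T∣≡2 ⟩
  2 + k         ∎
  where
  open ≡-Reasoning
  T : Subset (4 + k)
  T = colorClass (bookColoring {k}) zero

  ∣T∣≡2 : ∣ T ∣ ≡ 2
  ∣T∣≡2 = ≤-antisym (book-colorClass-size≤2 (bookColoring-distinguishing {k}) zero)
    (x∈p∧y∈p∧x≢y⇒2≤∣p∣ (colorClass⁺ (bookColoring {k}) {x = zero} refl)
                         (colorClass⁺ (bookColoring {k}) {x = suc (suc zero)} refl) (λ ()))

DetEqUpperPaintCostEqFrugalDist : Graph N → ℕ → Set
DetEqUpperPaintCostEqFrugalDist G n = IsDet G n × IsUpperPaintCost G n × IsFrugalDist G n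

book-theorem : ∀ k → DetEqUpperPaintCostEqFrugalDist (bookOn (4 + k)) (2 + k)
book-theorem k = det , (2 + k , dist , paint) , (2 + k , det , paint) , frugal-lower
  where
  det : IsDet (bookOn (4 + k)) (2 + k)
  det = (∁ (colorClass bookColoring zero) , ∁colorClass-determining bookColoring-distinguishing zero
        , bookColoring-paintCost)
      , λ _ → book-determining-size≥

  dist : IsDist (bookOn (4 + k)) (2 + k)
  dist = (bookColoring , bookColoring-distinguishing) , λ _ (_ , c-dist) → book-colors≥apexes c-dist

  paint : IsPaintCost (bookOn (4 + k)) (2 + k) (2 + k)
  paint = (bookColoring , bookColoring-distinguishing , zero , bookColoring-paintCost)
        , λ _ → book-paintCost≥

  frugal-lower : ∀ d → RhoEqDet (bookOn (4 + k)) d → 2 + k ≤ d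
  frugal-lower _ (_ , _ , (_ , c-dist , _) , _) = book-colors≥apexes c-dist

mainTheorem12 : (n : ℕ) → 2 ≤ n →
    IsDet (book3 n) n × IsUpperPaintCost (book3 n) n × IsFrugalDist (book3 n) n
mainTheorem12 n@(ℕ.suc (ℕ.suc k)) _ =
  subst (λ N → DetEqUpperPaintCostEqFrugalDist (bookOn N) n) (+-comm 2 n) (book-theorem k)
mainTheorem12 1 (s≤s ())
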